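{- In $\mathrm{Free}(\mathcal E)$, a 1-morphism in pseudomonoid form is untwisted.
   Context: $\mathcal E$ is the extended Frobenius presentation with object $C$ and generating 1-morphisms $m: C\boxtimes C\to C$, $u:1\to C$, $\cup: 1\to C\boxtimes C$, $f: C\to 1$, $\cap: C\boxtimes C\to 1$ (plus 2-morphisms); $\mathrm{Free}(\mathcal E)$ is the free monoidal bicategory it generates; string diagrams are read bottom to top. A 1-morphism is simple if its string diagram graph is connected and acyclic and it has a unique output wire; it is in pseudomonoid form if it is simple and built only from $m$ and $u$ generators. For an $m$, $u$ or $f$ vertex $v$ of a simple 1-morphism, $\mathrm{Tw}(v)$ is the number of right turns minus left turns along the shortest path from $v$ to the unique output (turns occur at cups and caps, and when passing through an $m$ vertex from one input leg to the other); untwisted means $\mathrm{Tw}(v)=0$ for all such $v$. -}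

module Defs where

-- A combinatorial model of the string diagrams of 1-morphisms of Free(E).
-- Objects of Free(E) are (bracketed) tensor words in C and the unit; the
-- string diagram only sees the number of C-wires, so an object is a ℕ.
-- Coherence 1-cells (associators, unitors and their pseudo-inverses) have
-- identity string diagrams and are represented by  idt n .

open import Data.Nat using (ℕ; zero; suc; _≤_)
open import Data.Fin using (Fin; toℕ; splitAt; _↑ˡ_; _↑ʳ_)
open import Data.Sum using (_⊎_; inj₁; inj₂)
open import Data.Product using (Σ; _,_; _×_)
open import Data.Unit using (⊤; tt)
open import Data.Empty using (⊥)
open import Data.List using (List; []; _∷_)
open import Data.List.Relation.Unary.AllPairs using (AllPairs)
open import Data.Integer using (ℤ; 0ℤ; 1ℤ; -1ℤ) renaming (_+_ to _+ℤ_)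
open import Relation.Binary.PropositionalEquality using (_≡_; _≢_)

data Gen : Set where
  m u cupG f capG : Gen

ins : Gen → ℕ
ins m    = 2
ins u    = 0
ins cupG = 0
ins f    = 1
ins capG = 2

outs : Gen → ℕ
outs m    = 1
outs u    = 1
outs cupG = 2
outs f    = 0
outs capG = 0

-- 1-morphism expressions of Free(E): Term a b : C^a → C^b
-- (g ∘ₜ s : first s, then g; diagrams read bottom to top; in s ⊗ₜ t,
--  s is drawn to the left of t)
data Term : ℕ → ℕ → Set where
  gen  : (g : Gen) → Term (ins g) (outs g)
  idt  : (n : ℕ) → Term n n
  _∘ₜ_ : ∀ {a b c} → Term b c → Term a b → Term a c
  _⊗ₜ_ : ∀ {a b c d} → Term a b → Term c d → Term (a Data.Nat.+ c) (b Data.Nat.+ d)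

Vertex : ∀ {a b} → Term a b → Set
Vertex (gen g)  = ⊤
Vertex (idt n)  = ⊥
Vertex (t ∘ₜ s) = Vertex s ⊎ Vertex t
Vertex (s ⊗ₜ t) = Vertex s ⊎ Vertex t

kind : ∀ {a b} (t : Term a b) → Vertex t → Gen
kind (gen g)  _        = g
kind (idt n)  ()
kind (t ∘ₜ s) (inj₁ v) = kind s v
kind (t ∘ₜ s) (inj₂ v) = kind t v
kind (s ⊗ₜ t) (inj₁ v) = kind s v
kind (s ⊗ₜ t) (inj₂ v) = kind t v

-- ports of a generator: inputs (numbered left to right) and outputs
Port : Gen → Set
Port g = Fin (ins g) ⊎ Fin (outs g)

VP : ∀ {a b} → Term a b → Set
VP t = Σ (Vertex t) (λ v → Port (kind t v))

private
  vpL∘ : ∀ {a b c} {t : Term b c} {s : Term a b} → VP s → VP (t ∘ₜ s)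
  vpL∘ (v , p) = inj₁ v , p
  vpR∘ : ∀ {a b c} {t : Term b c} {s : Term a b} → VP t → VP (t ∘ₜ s)
  vpR∘ (v , p) = inj₂ v , p
  vpL⊗ : ∀ {a b c d} {s : Term a b} {t : Term c d} → VP s → VP (s ⊗ₜ t)
  vpL⊗ (v , p) = inj₁ v , p
  vpR⊗ : ∀ {a b c d} {s : Term a b} {t : Term c d} → VP t → VP (s ⊗ₜ t)
  vpR⊗ (v , p) = inj₂ v , p

  mapS : ∀ {A B C D : Set} → (A → B) → (C → D) → A ⊎ C → B ⊎ D
  mapS g h (inj₁ x) = inj₁ (g x)
  mapS g h (inj₂ y) = inj₂ (h y)

-- Wiring: the other end of the wire starting at a given end.
--   fromSrc t i : the end joined to the i-th input boundary point
--   fromTgt t j : the end joined to the j-th output boundary point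
--   fromVP  t p : the end joined to the vertex port p
--   (results: vertex port, or input boundary (inj₁), or output boundary (inj₂))
mutual
  fromSrc : ∀ {a b} (t : Term a b) → Fin a → VP t ⊎ Fin b
  fromSrc (gen g) i = inj₁ (tt , inj₁ i)
  fromSrc (idt n) i = inj₂ i
  fromSrc (t ∘ₜ s) i = srcComp t s (fromSrc s i)
  fromSrc (_⊗ₜ_ {a} {b} {c} {d} s t) i = srcTens s t (splitAt a i)

  srcComp : ∀ {a b c} (t : Term b c) (s : Term a b) → VP s ⊎ Fin b → VP (t ∘ₜ s) ⊎ Fin c
  srcComp t s (inj₁ p) = inj₁ (vpL∘ p)
  srcComp t s (inj₂ j) = mapS vpR∘ (λ k → k) (fromSrc t j)

  srcTens : ∀ {a b c d} (s : Term a b) (t : Term c d) → Fin a ⊎ Fin c → VP (s ⊗ₜ t) ⊎ Fin (b Data.Nat.+ d)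
  srcTens {d = d} s t (inj₁ i) = mapS vpL⊗ (_↑ˡ d) (fromSrc s i)
  srcTens {b = b} s t (inj₂ i) = mapS vpR⊗ (b ↑ʳ_) (fromSrc t i)

  fromTgt : ∀ {a b} (t : Term a b) → Fin b → VP t ⊎ Fin a
  fromTgt (gen g) j = inj₁ (tt , inj₂ j)
  fromTgt (idt n) j = inj₂ j
  fromTgt (t ∘ₜ s) k = tgtComp t s (fromTgt t k)
  fromTgt (_⊗ₜ_ {a} {b} {c} {d} s t) j = tgtTens s t (splitAt b j)

  tgtComp : ∀ {a b c} (t : Term b c) (s : Term a b) → VP t ⊎ Fin b → VP (t ∘ₜ s) ⊎ Fin a
  tgtComp t s (inj₁ p) = inj₁ (vpR∘ p)
  tgtComp t s (inj₂ j) = mapS vpL∘ (λ i → i) (fromTgt s j)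

  tgtTens : ∀ {a b c d} (s : Term a b) (t : Term c d) → Fin b ⊎ Fin d → VP (s ⊗ₜ t) ⊎ Fin (a Data.Nat.+ c)
  tgtTens {c = c} s t (inj₁ j) = mapS vpL⊗ (_↑ˡ c) (fromTgt s j)
  tgtTens {a = a} s t (inj₂ j) = mapS vpR⊗ (a ↑ʳ_) (fromTgt t j)

  fromVP : ∀ {a b} (t : Term a b) → VP t → VP t ⊎ (Fin a ⊎ Fin b)
  fromVP (gen g) (tt , inj₁ i) = inj₂ (inj₁ i)
  fromVP (gen g) (tt , inj₂ j) = inj₂ (inj₂ j)
  fromVP (idt n) (() , _)
  fromVP (t ∘ₜ s) (inj₁ v , p) = vpCompL t s (fromVP s (v , p))
  fromVP (t ∘ₜ s) (inj₂ v , p) = vpCompR t s (fromVP t (v , p))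
  fromVP (_⊗ₜ_ {a} {b} {c} {d} s t) (inj₁ v , p) =
    mapS vpL⊗ (mapS (_↑ˡ c) (_↑ˡ d)) (fromVP s (v , p))
  fromVP (_⊗ₜ_ {a} {b} {c} {d} s t) (inj₂ v , p) =
    mapS vpR⊗ (mapS (a ↑ʳ_) (b ↑ʳ_)) (fromVP t (v , p))

  vpCompL : ∀ {a b c} (t : Term b c) (s : Term a b) → VP s ⊎ (Fin a ⊎ Fin b) → VP (t ∘ₜ s) ⊎ (Fin a ⊎ Fin c)
  vpCompL t s (inj₁ p) = inj₁ (vpL∘ p)
  vpCompL t s (inj₂ (inj₁ i)) = inj₂ (inj₁ i)
  vpCompL t s (inj₂ (inj₂ j)) = mapS vpR∘ inj₂ (fromSrc t j)

  vpCompR : ∀ {a b c} (t : Term b c) (s : Term a b) → VP t ⊎ (Fin b ⊎ Fin c) → VP (t ∘ₜ s) ⊎ (Fin a ⊎ Fin c)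
  vpCompR t s (inj₁ p) = inj₁ (vpR∘ p)
  vpCompR t s (inj₂ (inj₂ k)) = inj₂ (inj₂ k)
  vpCompR t s (inj₂ (inj₁ j)) = mapS vpL∘ inj₁ (fromTgt s j)

data End {a b} (t : Term a b) : Set where
  port : (v : Vertex t) → Port (kind t v) → End t
  src  : Fin a → End t
  tgt  : Fin b → End t

private
  ofVP : ∀ {a b} {t : Term a b} → VP t → End t
  ofVP (v , p) = port v p

partner : ∀ {a b} (t : Term a b) → End t → End t
partner t (port v p) with fromVP t (v , p)
... | inj₁ q = ofVP q
... | inj₂ (inj₁ i) = src i
... | inj₂ (inj₂ j) = tgt j
partner t (src i) with fromSrc t i
... | inj₁ q = ofVP q
... | inj₂ j = tgt j
partner t (tgt j) with fromTgt t j
... | inj₁ q = ofVP q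
... | inj₂ i = src i

-- Nodes of the string diagram graph: generator vertices and boundary points;
-- edges are the wires.
data Node {a b} (t : Term a b) : Set where
  vert : Vertex t → Node t
  inN  : Fin a → Node t
  outN : Fin b → Node t

node : ∀ {a b} (t : Term a b) → End t → Node t
node t (port v p) = vert v
node t (src i) = inN i
node t (tgt j) = outN j

-- walks: each step leaves the current node along the wire at end e
data Walk {a b} (t : Term a b) : Node t → Node t → Set where
  []   : ∀ {N} → Walk t N N
  step : ∀ {N M} (e : End t) → node t e ≡ N → Walk t (node t (partner t e)) M → Walk t N M

walkLength : ∀ {a b} {t : Term a b} {N M} → Walk t N M → ℕ
walkLength []             = 0
walkLength (step e _ w)   = suc (walkLength w)

ends : ∀ {a b} {t : Term a b} {N M} → Walk t N M → List (End t)
ends []           = []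
ends (step e _ w) = e ∷ ends w

-- a trail uses each wire (edge) at most once
Trail : ∀ {a b} {t : Term a b} {N M} → Walk t N M → Set
Trail {t = t} w = AllPairs (λ x y → x ≢ y × x ≢ partner t y) (ends w)

Connected : ∀ {a b} → Term a b → Set
Connected t = ∀ N M → Walk t N M

Acyclic : ∀ {a b} → Term a b → Set
Acyclic t = ∀ {N} (w : Walk t N N) → Trail w → walkLength w ≡ 0

Simple : ∀ {a b} → Term a b → Set
Simple {b = b} t = Connected t × Acyclic t × b ≡ 1

PseudomonoidForm : ∀ {a b} → Term a b → Set
PseudomonoidForm t = Simple t × (∀ v → kind t v ≡ m ⊎ kind t v ≡ u)

data PortI : Set where
  inp outp : ℕ → PortI

info : ∀ {g} → Port g → PortI
info (inj₁ i) = inp (toℕ i)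
info (inj₂ j) = outp (toℕ j)

-- turn made when passing through a vertex of the given kind,
-- arriving at the first port and leaving from the second (+1 right, -1 left):
--  cup: down the left leg and up the right leg is a left turn;
--  cap and m: up the left input and down the right input is a right turn.
turnK : Gen → PortI → PortI → ℤ
turnK cupG (outp 0) (outp 1) = -1ℤ
turnK cupG (outp 1) (outp 0) = 1ℤ
turnK capG (inp 0) (inp 1) = 1ℤ
turnK capG (inp 1) (inp 0) = -1ℤ
turnK m (inp 0) (inp 1) = 1ℤ
turnK m (inp 1) (inp 0) = -1ℤ
turnK _ _ _ = 0ℤ

turnAt : ∀ {a b} (t : Term a b) → End t → End t → ℤ
turnAt t (port v p) (port w q) = turnK (kind t v) (info p) (info q)
turnAt t _ _ = 0ℤ

turnsList : ∀ {a b} (t : Term a b) → List (End t) → ℤ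
turnsList t [] = 0ℤ
turnsList t (e ∷ []) = 0ℤ
turnsList t (e ∷ e' ∷ es) = turnAt t (partner t e) e' +ℤ turnsList t (e' ∷ es)

turns : ∀ {a b} {t : Term a b} {N M} → Walk t N M → ℤ
turns {t = t} w = turnsList t (ends w)

TwVertex : Gen → Set
TwVertex m = ⊤
TwVertex u = ⊤
TwVertex f = ⊤
TwVertex _ = ⊥

Shortest : ∀ {a} {t : Term a 1} {v : Vertex t} → Walk t (vert v) (outN Data.Fin.zero) → Set
Shortest {t = t} {v} w = ∀ (w' : Walk t (vert v) (outN Data.Fin.zero)) → walkLength w ≤ walkLength w'

Untwisted : ∀ {a} → Term a 1 → Set
Untwisted t = ∀ (v : Vertex t) → TwVertex (kind t v) →
  (w : Walk t (vert v) (outN Data.Fin.zero)) → Shortest w → turns w ≡ 0ℤ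

module Submission where

-- Every wire of a term runs upward: from a generator output or an input boundary
-- point (its bottom end) to a generator input or an output boundary point (its
-- top end). Without cups each node carries at most one bottom end, so a walk that
-- steps down and afterwards reaches an output only by climbing must retrace that
-- step at once; hence a shortest walk to an output climbs all the way. A climbing
-- walk leaves every vertex through an output port, and such a passage is never a
-- turn unless the vertex is a cup.

open import Defs
open import Data.Nat using (zero; suc; _≤_; _<_; s≤s)
open import Data.Nat.Properties using (<⇒≱; n<1+n; m≤n⇒m≤1+n)
open import Data.Fin using (Fin; zero; splitAt; _↑ˡ_; _↑ʳ_)
open import Data.Fin.Properties using (splitAt-↑ˡ; splitAt-↑ʳ; splitAt⁻¹-↑ˡ; splitAt⁻¹-↑ʳ)
open import Data.Sum using (_⊎_; inj₁; inj₂)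
open import Data.Product using (Σ; _,_; proj₂)
open import Data.Unit using (⊤; tt)
open import Data.Empty using (⊥; ⊥-elim)
open import Data.List using (List; []; _∷_)
open import Data.List.Relation.Unary.All using (All; []; _∷_)
open import Data.Integer using (0ℤ) renaming (_+_ to _+ℤ_)
open import Relation.Binary.PropositionalEquality using (_≡_; _≢_; refl; sym; trans; cong; cong₂)

SrcInverse : ∀ {a b} (t : Term a b) → Fin a → VP t ⊎ Fin b → Set
SrcInverse t i (inj₁ q) = fromVP t q ≡ inj₂ (inj₁ i)
SrcInverse t i (inj₂ j) = fromTgt t j ≡ inj₂ i

TgtInverse : ∀ {a b} (t : Term a b) → Fin b → VP t ⊎ Fin a → Set
TgtInverse t j (inj₁ q) = fromVP t q ≡ inj₂ (inj₂ j)
TgtInverse t j (inj₂ i) = fromSrc t i ≡ inj₂ j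

VPInverse : ∀ {a b} (t : Term a b) → VP t → VP t ⊎ (Fin a ⊎ Fin b) → Set
VPInverse t q (inj₁ q′)        = fromVP t q′ ≡ inj₁ q
VPInverse t q (inj₂ (inj₁ i)) = fromSrc t i ≡ inj₁ q
VPInverse t q (inj₂ (inj₂ j)) = fromTgt t j ≡ inj₁ q

mutual
  fromSrc-inverse : ∀ {a b} (t : Term a b) (i : Fin a) → SrcInverse t i (fromSrc t i)
  fromSrc-inverse (gen g) i = refl
  fromSrc-inverse (idt n) i = refl
  fromSrc-inverse (t ∘ₜ s) i with fromSrc s i | fromSrc-inverse s i
  ... | inj₁ _ | h rewrite h = refl
  ... | inj₂ j | h with fromSrc t j | fromSrc-inverse t j
  ...   | inj₁ _ | h′ rewrite h′ | h = refl
  ...   | inj₂ _ | h′ rewrite h′ | h = refl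
  fromSrc-inverse (_⊗ₜ_ {a} {b} {c} {d} s t) i with splitAt a i in eq
  ... | inj₁ i′ with fromSrc s i′ | fromSrc-inverse s i′
  ...   | inj₁ _ | h rewrite h = cong (λ x → inj₂ (inj₁ x)) (splitAt⁻¹-↑ˡ eq)
  ...   | inj₂ j | h rewrite splitAt-↑ˡ b j d | h = cong inj₂ (splitAt⁻¹-↑ˡ eq)
  fromSrc-inverse (_⊗ₜ_ {a} {b} {c} {d} s t) i | inj₂ i′ with fromSrc t i′ | fromSrc-inverse t i′
  ...   | inj₁ _ | h rewrite h = cong (λ x → inj₂ (inj₁ x)) (splitAt⁻¹-↑ʳ eq)
  ...   | inj₂ j | h rewrite splitAt-↑ʳ b d j | h = cong inj₂ (splitAt⁻¹-↑ʳ eq)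

  fromTgt-inverse : ∀ {a b} (t : Term a b) (j : Fin b) → TgtInverse t j (fromTgt t j)
  fromTgt-inverse (gen g) j = refl
  fromTgt-inverse (idt n) j = refl
  fromTgt-inverse (t ∘ₜ s) k with fromTgt t k | fromTgt-inverse t k
  ... | inj₁ _ | h rewrite h = refl
  ... | inj₂ j | h with fromTgt s j | fromTgt-inverse s j
  ...   | inj₁ _ | h′ rewrite h′ | h = refl
  ...   | inj₂ _ | h′ rewrite h′ | h = refl
  fromTgt-inverse (_⊗ₜ_ {a} {b} {c} {d} s t) j with splitAt b j in eq
  ... | inj₁ j′ with fromTgt s j′ | fromTgt-inverse s j′
  ...   | inj₁ _ | h rewrite h = cong (λ x → inj₂ (inj₂ x)) (splitAt⁻¹-↑ˡ eq)
  ...   | inj₂ i | h rewrite splitAt-↑ˡ a i c | h = cong inj₂ (splitAt⁻¹-↑ˡ eq)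
  fromTgt-inverse (_⊗ₜ_ {a} {b} {c} {d} s t) j | inj₂ j′ with fromTgt t j′ | fromTgt-inverse t j′
  ...   | inj₁ _ | h rewrite h = cong (λ x → inj₂ (inj₂ x)) (splitAt⁻¹-↑ʳ eq)
  ...   | inj₂ i | h rewrite splitAt-↑ʳ a c i | h = cong inj₂ (splitAt⁻¹-↑ʳ eq)

  fromVP-inverse : ∀ {a b} (t : Term a b) (q : VP t) → VPInverse t q (fromVP t q)
  fromVP-inverse (gen g) (tt , inj₁ i) = refl
  fromVP-inverse (gen g) (tt , inj₂ j) = refl
  fromVP-inverse (idt n) (() , _)
  fromVP-inverse (t ∘ₜ s) (inj₁ v , p) with fromVP s (v , p) | fromVP-inverse s (v , p)
  ... | inj₁ _        | h rewrite h = refl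
  ... | inj₂ (inj₁ _) | h rewrite h = refl
  ... | inj₂ (inj₂ j) | h with fromSrc t j | fromSrc-inverse t j
  ...   | inj₁ _ | h′ rewrite h′ | h = refl
  ...   | inj₂ _ | h′ rewrite h′ | h = refl
  fromVP-inverse (t ∘ₜ s) (inj₂ v , p) with fromVP t (v , p) | fromVP-inverse t (v , p)
  ... | inj₁ _        | h rewrite h = refl
  ... | inj₂ (inj₂ _) | h rewrite h = refl
  ... | inj₂ (inj₁ j) | h with fromTgt s j | fromTgt-inverse s j
  ...   | inj₁ _ | h′ rewrite h′ | h = refl
  ...   | inj₂ _ | h′ rewrite h′ | h = refl
  fromVP-inverse (_⊗ₜ_ {a} {b} {c} {d} s t) (inj₁ v , p) with fromVP s (v , p) | fromVP-inverse s (v , p)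
  ... | inj₁ _        | h rewrite h = refl
  ... | inj₂ (inj₁ i) | h rewrite splitAt-↑ˡ a i c | h = refl
  ... | inj₂ (inj₂ j) | h rewrite splitAt-↑ˡ b j d | h = refl
  fromVP-inverse (_⊗ₜ_ {a} {b} {c} {d} s t) (inj₂ v , p) with fromVP t (v , p) | fromVP-inverse t (v , p)
  ... | inj₁ _        | h rewrite h = refl
  ... | inj₂ (inj₁ i) | h rewrite splitAt-↑ʳ a c i | h = refl
  ... | inj₂ (inj₂ j) | h rewrite splitAt-↑ʳ b d j | h = refl

partner-involutive : ∀ {a b} (t : Term a b) (e : End t) → partner t (partner t e) ≡ e
partner-involutive t (port v p) with fromVP t (v , p) | fromVP-inverse t (v , p)
... | inj₁ _        | h rewrite h = refl
... | inj₂ (inj₁ _) | h rewrite h = refl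
... | inj₂ (inj₂ _) | h rewrite h = refl
partner-involutive t (src i) with fromSrc t i | fromSrc-inverse t i
... | inj₁ _ | h rewrite h = refl
... | inj₂ _ | h rewrite h = refl
partner-involutive t (tgt j) with fromTgt t j | fromTgt-inverse t j
... | inj₁ _ | h rewrite h = refl
... | inj₂ _ | h rewrite h = refl

IsInput : ∀ {g} → Port g → Set
IsInput (inj₁ _) = ⊤
IsInput (inj₂ _) = ⊥

IsOutput : ∀ {g} → Port g → Set
IsOutput (inj₁ _) = ⊥
IsOutput (inj₂ _) = ⊤

BottomEnd : ∀ {a b} {t : Term a b} → End t → Set
BottomEnd (port v p) = IsOutput p
BottomEnd (src _)    = ⊤
BottomEnd (tgt _)    = ⊥

TopEnd : ∀ {a b} {t : Term a b} → End t → Set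
TopEnd (port v p) = IsInput p
TopEnd (src _)    = ⊥
TopEnd (tgt _)    = ⊤

bottomEnd⊎topEnd : ∀ {a b} {t : Term a b} (e : End t) → BottomEnd e ⊎ TopEnd e
bottomEnd⊎topEnd (port v (inj₁ _)) = inj₂ tt
bottomEnd⊎topEnd (port v (inj₂ _)) = inj₁ tt
bottomEnd⊎topEnd (src _)           = inj₁ tt
bottomEnd⊎topEnd (tgt _)           = inj₂ tt

BottomOrSrc : ∀ {a b} {t : Term a b} → VP t ⊎ Fin a → Set
BottomOrSrc (inj₁ q) = IsOutput (proj₂ q)
BottomOrSrc (inj₂ _) = ⊤

BottomOrSrcNotTgt : ∀ {a b} {t : Term a b} → VP t ⊎ (Fin a ⊎ Fin b) → Set
BottomOrSrcNotTgt (inj₁ q)        = IsOutput (proj₂ q)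
BottomOrSrcNotTgt (inj₂ (inj₁ _)) = ⊤
BottomOrSrcNotTgt (inj₂ (inj₂ _)) = ⊥

fromTgt-bottom : ∀ {a b} (t : Term a b) (j : Fin b) → BottomOrSrc (fromTgt t j)
fromTgt-bottom (gen g) j = tt
fromTgt-bottom (idt n) j = tt
fromTgt-bottom (t ∘ₜ s) k with fromTgt t k | fromTgt-bottom t k
... | inj₁ _ | h = h
... | inj₂ j | _ with fromTgt s j | fromTgt-bottom s j
...   | inj₁ _ | h = h
...   | inj₂ _ | _ = tt
fromTgt-bottom (_⊗ₜ_ {b = b} s t) j with splitAt b j
... | inj₁ j′ with fromTgt s j′ | fromTgt-bottom s j′
...   | inj₁ _ | h = h
...   | inj₂ _ | _ = tt
fromTgt-bottom (_⊗ₜ_ {b = b} s t) j | inj₂ j′ with fromTgt t j′ | fromTgt-bottom t j′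
...   | inj₁ _ | h = h
...   | inj₂ _ | _ = tt

fromVP-input-bottom : ∀ {a b} (t : Term a b) (v : Vertex t) (i : Fin (ins (kind t v))) →
                      BottomOrSrcNotTgt (fromVP t (v , inj₁ i))
fromVP-input-bottom (gen g) tt i = tt
fromVP-input-bottom (idt n) () i
fromVP-input-bottom (t ∘ₜ s) (inj₁ v) i with fromVP s (v , inj₁ i) | fromVP-input-bottom s v i
... | inj₁ _        | h = h
... | inj₂ (inj₁ _) | _ = tt
... | inj₂ (inj₂ _) | ()
fromVP-input-bottom (t ∘ₜ s) (inj₂ v) i with fromVP t (v , inj₁ i) | fromVP-input-bottom t v i
... | inj₁ _        | h = h
... | inj₂ (inj₂ _) | ()
... | inj₂ (inj₁ j) | _ with fromTgt s j | fromTgt-bottom s j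
...   | inj₁ _ | h = h
...   | inj₂ _ | _ = tt
fromVP-input-bottom (s ⊗ₜ t) (inj₁ v) i with fromVP s (v , inj₁ i) | fromVP-input-bottom s v i
... | inj₁ _        | h = h
... | inj₂ (inj₁ _) | _ = tt
... | inj₂ (inj₂ _) | ()
fromVP-input-bottom (s ⊗ₜ t) (inj₂ v) i with fromVP t (v , inj₁ i) | fromVP-input-bottom t v i
... | inj₁ _        | h = h
... | inj₂ (inj₁ _) | _ = tt
... | inj₂ (inj₂ _) | ()

partner-topEnd-bottom : ∀ {a b} (t : Term a b) (e : End t) → TopEnd e → BottomEnd (partner t e)
partner-topEnd-bottom t (port v (inj₁ i)) _ with fromVP t (v , inj₁ i) | fromVP-input-bottom t v i
... | inj₁ _        | h = h
... | inj₂ (inj₁ _) | _ = tt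
... | inj₂ (inj₂ _) | ()
partner-topEnd-bottom t (tgt j) _ with fromTgt t j | fromTgt-bottom t j
... | inj₁ _ | h = h
... | inj₂ _ | _ = tt

CupFree : ∀ {a b} → Term a b → Set
CupFree t = ∀ v → kind t v ≢ cupG

outputPort-unique : ∀ g → g ≢ cupG → (p q : Fin (outs g)) → p ≡ q
outputPort-unique m    _   zero zero = refl
outputPort-unique u    _   zero zero = refl
outputPort-unique cupG g≢ _    _    = ⊥-elim (g≢ refl)

bottomEnd-unique : ∀ {a b} {t : Term a b} → CupFree t → (e e′ : End t) →
                   BottomEnd e → BottomEnd e′ → node t e ≡ node t e′ → e ≡ e′
bottomEnd-unique {t = t} cupFree (port v (inj₂ p)) (port .v (inj₂ p′)) _ _ refl =
  cong (λ q → port v (inj₂ q)) (outputPort-unique (kind t v) (cupFree v) p p′)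
bottomEnd-unique cupFree (src i) (src .i) _ _ refl = refl
bottomEnd-unique cupFree (port v (inj₂ _)) (port _ (inj₁ _)) _ () _
bottomEnd-unique cupFree (port v (inj₂ _)) (src _) _ _ ()
bottomEnd-unique cupFree (port v (inj₂ _)) (tgt _) _ () _
bottomEnd-unique cupFree (src _) (port _ _) _ _ ()
bottomEnd-unique cupFree (src _) (tgt _) _ () _

OutputNode : ∀ {a b} {t : Term a b} → Node t → Set
OutputNode (outN _) = ⊤
OutputNode (vert _) = ⊥
OutputNode (inN _)  = ⊥

bottomEnd-not-output : ∀ {a b} {t : Term a b} (e : End t) → BottomEnd e → OutputNode (node t e) → ⊥
bottomEnd-not-output (port _ _) _ ()
bottomEnd-not-output (src _)    _ ()

Climbing : ∀ {a b} {t : Term a b} {N M} → Walk t N M → Set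
Climbing w = All BottomEnd (ends w)

ShorterWalk : ∀ {a b} {t : Term a b} {N M} → Walk t N M → Set
ShorterWalk {t = t} {N} {M} w = Σ (Walk t N M) λ w′ → walkLength w′ < walkLength w

moveStart : ∀ {a b} {t : Term a b} {N N′ M} → N ≡ N′ → (w : Walk t N M) →
            Σ (Walk t N′ M) λ w′ → walkLength w′ ≡ walkLength w
moveStart refl w = w , refl

descent-backtracks : ∀ {a b} {t : Term a b} → CupFree t → ∀ {M} (e : End t) → TopEnd e →
                     (w : Walk t (node t (partner t e)) M) → Climbing w → OutputNode M →
                     Σ (Walk t (node t e) M) λ w′ → walkLength w′ < suc (walkLength w)
descent-backtracks {t = t} cupFree e top [] _ out =
  ⊥-elim (bottomEnd-not-output (partner t e) (partner-topEnd-bottom t e top) out)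
descent-backtracks {t = t} cupFree e top (step e′ at w) (bottom′ ∷ _) _
  with moveStart backToStart w
  where
    e′≡partner : e′ ≡ partner t e
    e′≡partner = bottomEnd-unique cupFree e′ (partner t e) bottom′ (partner-topEnd-bottom t e top) at
    backToStart : node t (partner t e′) ≡ node t e
    backToStart = trans (cong (λ x → node t (partner t x)) e′≡partner) (cong (node t) (partner-involutive t e))
... | w′ , len rewrite sym len = w′ , m≤n⇒m≤1+n (n<1+n _)

climbing⊎shorter : ∀ {a b} {t : Term a b} → CupFree t → ∀ {N M} → OutputNode M →
                   (w : Walk t N M) → Climbing w ⊎ ShorterWalk w
climbing⊎shorter cupFree out [] = inj₁ []
climbing⊎shorter cupFree out (step e at w) with climbing⊎shorter cupFree out w
... | inj₂ (w′ , w′<w) = inj₂ (step e at w′ , s≤s w′<w)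
... | inj₁ climbing with bottomEnd⊎topEnd e
...   | inj₁ bottom = inj₁ (bottom ∷ climbing)
...   | inj₂ top with descent-backtracks cupFree e top w climbing out
...     | w′ , w′<w with moveStart at w′
...       | w″ , len rewrite sym len = inj₂ (w″ , w′<w)

turnK-outp : ∀ g x k → g ≢ cupG → turnK g x (outp k) ≡ 0ℤ
turnK-outp m    (inp zero)          k _ = refl
turnK-outp m    (inp (suc zero))    k _ = refl
turnK-outp m    (inp (suc (suc _))) k _ = refl
turnK-outp m    (outp _)            k _ = refl
turnK-outp capG (inp zero)          k _ = refl
turnK-outp capG (inp (suc zero))    k _ = refl
turnK-outp capG (inp (suc (suc _))) k _ = refl
turnK-outp capG (outp _)            k _ = refl
turnK-outp u    x                   k _ = refl
turnK-outp f    x                   k _ = refl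
turnK-outp cupG x                   k g≢ = ⊥-elim (g≢ refl)

turnAt-bottom : ∀ {a b} {t : Term a b} → CupFree t → (x e : End t) → BottomEnd e → turnAt t x e ≡ 0ℤ
turnAt-bottom {t = t} cupFree (port v p) (port _ (inj₂ _)) _ = turnK-outp (kind t v) (info p) _ (cupFree v)
turnAt-bottom cupFree (port _ _) (src _) _ = refl
turnAt-bottom cupFree (src _)    _       _ = refl
turnAt-bottom cupFree (tgt _)    _       _ = refl

turnsList-bottom : ∀ {a b} {t : Term a b} → CupFree t → (es : List (End t)) → All BottomEnd es →
                   turnsList t es ≡ 0ℤ
turnsList-bottom cupFree []           _  = refl
turnsList-bottom cupFree (e ∷ [])     _  = refl
turnsList-bottom {t = t} cupFree (e ∷ e′ ∷ es) (_ ∷ bottoms@(bottom′ ∷ _)) =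
  cong₂ _+ℤ_ (turnAt-bottom cupFree (partner t e) e′ bottom′) (turnsList-bottom cupFree (e′ ∷ es) bottoms)

shortestToOutput-turns≡0 : ∀ {a b} {t : Term a b} → CupFree t → ∀ {N M} → OutputNode M →
                           (w : Walk t N M) → (∀ w′ → walkLength w ≤ walkLength w′) → turns w ≡ 0ℤ
shortestToOutput-turns≡0 cupFree out w shortest with climbing⊎shorter cupFree out w
... | inj₁ climbing     = turnsList-bottom cupFree (ends w) climbing
... | inj₂ (w′ , w′<w) = ⊥-elim (<⇒≱ w′<w (shortest w′))

m⊎u-not-cup : ∀ {g} → g ≡ m ⊎ g ≡ u → g ≢ cupG
m⊎u-not-cup (inj₁ refl) ()
m⊎u-not-cup (inj₂ refl) ()

pseudomonoidForm-cupFree : ∀ {a b} {t : Term a b} → PseudomonoidForm t → CupFree t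
pseudomonoidForm-cupFree (_ , kinds) v = m⊎u-not-cup (kinds v)

mainTheorem11 : ∀ {a} (t : Term a 1) → PseudomonoidForm t → Untwisted t
mainTheorem11 t pseudomonoid v _ w shortest =
  shortestToOutput-turns≡0 (pseudomonoidForm-cupFree pseudomonoid) tt w shortest
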